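{- Let $L$ be a pinwheel covering instance (finite list of positive integers) with $D(L)\ge\sum_{i=0}^\infty\frac{1}{2^i+1}$. Let $W$ denote the infinite multiset $\{2^i+1: i\ge 0\}=\{2,3,5,9,\dots\}$. Let $S$ be the set of powers of two $p=2^k$ ($k\ge 0$ an integer) such that $D(L\le p)>D(W\le p)$. Then $S$ is nonempty.
   Context: For a multiset $A$ of positive reals, $D(A)=\sum_{a\in A}1/a$ (with multiplicity). $A\le r$ denotes the sub-multiset of elements of $A$ that are at most $r$. -}

module Defs where

open import Data.Nat using (ℕ; zero; suc; _^_; _+_; _≤?_)
open import Data.Integer using (+_)
open import Data.Rational using (ℚ; 0ℚ; _/_)
open import Data.List using (List; []; _∷_; map; foldr; filter; upTo)

-- reciprocal 1/a of a positive integer (the value at 0 is irrelevant: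
-- elements of instances are required to be positive)
recip : ℕ → ℚ
recip zero    = 0ℚ
recip (suc n) = (+ 1) / suc n

sumℚ : List ℚ → ℚ
sumℚ = foldr Data.Rational._+_ 0ℚ

D : List ℕ → ℚ
D A = sumℚ (map recip A)

_≤ₘ_ : List ℕ → ℕ → List ℕ
A ≤ₘ r = filter (λ a → a ≤? r) A

w : ℕ → ℕ
w i = 2 ^ i + 1

-- W ≤ p as a finite multiset: every element 2^i+1 ≤ p has i < p,
-- so it suffices to filter the first p elements of W.
W≤ : ℕ → List ℕ
W≤ p = map w (upTo p) ≤ₘ p

partialW : ℕ → ℚ
partialW N = D (map w (upTo N))

module Submission where

open import Defs
open import Data.Nat using (ℕ; _<_; _^_)
import Data.Rational
open import Data.List using (List)
open import Data.List.Relation.Unary.All using (All)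
open import Data.Product using (∃)

open import Data.Nat as ℕ using (zero; suc; z≤n; s≤s; _≤?_)
import Data.Nat.Properties as ℕ
open import Data.Rational as ℚ using (0ℚ)
import Data.Rational.Properties as ℚ
open import Data.List using ([]; _∷_; map; upTo)
open import Data.List.Extrema.Nat using (max; xs≤max)
open import Data.List.Membership.Propositional using (_∈_)
open import Data.List.Membership.Propositional.Properties using (∈-map⁺; ∈-upTo⁺)
open import Data.List.Properties using (filter-all; filter-accept; filter-reject)
open import Data.List.Relation.Unary.Any using (here; there)
import Data.List.Relation.Unary.All as All
open import Data.Product using (_,_)
open import Relation.Nullary using (¬_; yes; no)
open import Relation.Binary.PropositionalEquality using (_≡_; refl; sym; cong; subst)

-- Take p = 2^k with k at least every element of L, so that L ≤ p = L.

recip-nonNeg : ∀ n → 0ℚ ℚ.≤ recip n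
recip-nonNeg zero    = ℚ.≤-refl
recip-nonNeg (suc n) = ℚ.nonNegative⁻¹ _ {{ℚ.normalize-nonNeg 1 (suc n)}}

recip-pos : ∀ n → 0ℚ ℚ.< recip (suc n)
recip-pos n = ℚ.positive⁻¹ _ {{ℚ.normalize-pos 1 (suc n)}}

p≤q+p : ∀ {p q} → 0ℚ ℚ.≤ q → p ℚ.≤ q ℚ.+ p
p≤q+p {p} {q} 0≤q = subst (ℚ._≤ q ℚ.+ p) (ℚ.+-identityˡ p) (ℚ.+-monoˡ-≤ p 0≤q)

p<q+p : ∀ {p q} → 0ℚ ℚ.< q → p ℚ.< q ℚ.+ p
p<q+p {p} {q} 0<q = subst (ℚ._< q ℚ.+ p) (ℚ.+-identityˡ p) (ℚ.+-monoˡ-< p 0<q)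

≤ₘ-accept : ∀ {p x} xs → x ℕ.≤ p → (x ∷ xs) ≤ₘ p ≡ x ∷ (xs ≤ₘ p)
≤ₘ-accept {p} _ = filter-accept (_≤? p)

≤ₘ-reject : ∀ {p x} xs → ¬ x ℕ.≤ p → (x ∷ xs) ≤ₘ p ≡ xs ≤ₘ p
≤ₘ-reject {p} _ = filter-reject (_≤? p)

D-≤ₘ-≤ : ∀ p xs → D (xs ≤ₘ p) ℚ.≤ D xs
D-≤ₘ-≤ p []       = ℚ.≤-refl
D-≤ₘ-≤ p (x ∷ xs) with x ≤? p
... | yes x≤p rewrite ≤ₘ-accept xs x≤p = ℚ.+-monoʳ-≤ (recip x) (D-≤ₘ-≤ p xs)
... | no  x≰p rewrite ≤ₘ-reject xs x≰p = ℚ.≤-trans (D-≤ₘ-≤ p xs) (p≤q+p (recip-nonNeg x))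

D-≤ₘ-< : ∀ p {x} xs → x ∈ xs → p < x → D (xs ≤ₘ p) ℚ.< D xs
D-≤ₘ-< p (suc x ∷ xs) (here refl) p<x rewrite ≤ₘ-reject xs (ℕ.<⇒≱ p<x) =
  ℚ.≤-<-trans (D-≤ₘ-≤ p xs) (p<q+p (recip-pos x))
D-≤ₘ-< p (zero ∷ xs) (here refl) ()
D-≤ₘ-< p (y ∷ xs) (there x∈xs) p<x with y ≤? p
... | yes y≤p rewrite ≤ₘ-accept xs y≤p = ℚ.+-monoʳ-< (recip y) (D-≤ₘ-< p xs x∈xs p<x)
... | no  y≰p rewrite ≤ₘ-reject xs y≰p = ℚ.<-≤-trans (D-≤ₘ-< p xs x∈xs p<x) (p≤q+p (recip-nonNeg y))

≤ₘ-all : ∀ p xs → All (ℕ._≤ p) xs → xs ≤ₘ p ≡ xs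
≤ₘ-all p _ = filter-all (λ a → a ≤? p)

n<2^n : ∀ n → n < 2 ^ n
n<2^n zero    = s≤s z≤n
n<2^n (suc n) = ℕ.+-mono-≤ (ℕ.m^n>0 2 n) (ℕ.≤-trans (n<2^n n) (ℕ.m≤m+n (2 ^ n) 0))

D-W≤-<-partialW : ∀ k → D (W≤ (2 ^ k)) ℚ.< partialW (2 ^ k)
D-W≤-<-partialW k =
  D-≤ₘ-< (2 ^ k) (map w (upTo (2 ^ k))) (∈-map⁺ w (∈-upTo⁺ (n<2^n k))) (ℕ.m<m+n (2 ^ k) ℕ.0<1+n)

lemma4p1 : (L : List ℕ) → All (λ a → 0 Data.Nat.< a) L →
    (∀ N → partialW N Data.Rational.≤ D L) →
    ∃ λ k → D (W≤ (2 ^ k)) Data.Rational.< D (L ≤ₘ (2 ^ k))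
lemma4p1 L _ partialW≤D = k , subst (D (W≤ (2 ^ k)) ℚ.<_) (cong D (sym L≤p)) D-W≤<D-L
  where
  k : ℕ
  k = max 0 L

  L≤p : L ≤ₘ (2 ^ k) ≡ L
  L≤p = ≤ₘ-all (2 ^ k) L (All.map (λ a≤k → ℕ.≤-trans a≤k (ℕ.<⇒≤ (n<2^n k))) (xs≤max 0 L))

  D-W≤<D-L : D (W≤ (2 ^ k)) ℚ.< D L
  D-W≤<D-L = ℚ.<-≤-trans (D-W≤-<-partialW k) (partialW≤D (2 ^ k))
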